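{- Let $\tau$ consist of two binary relation symbols $E$ and $N$, and let $T$ be the theory consisting only of the sentence $$\forall x,y.\big(\neg E(x,x)\wedge\neg(E(x,y)\wedge\neg E(y,x))\wedge\neg N(x,x)\wedge\neg(E(x,y)\wedge N(x,y))\big).$$ Then there is a sampling for $T$, but there is no polynomial sampling for $T$.
   Context: An atomic $\tau$-formula is of the form $R(x_1,\dots,x_k)$ with $R\in\tau$ of arity $k$, or $x_1=x_2$, or $\bot$. A sampling for a $\tau$-theory $T$ is a sequence $(L_n)_{n\in\mathbb{N}}$ of finite sets of finite $\tau$-structures such that for all $n$ and every conjunction $\phi$ of atomic $\tau$-formulas with at most $n$ variables, $\phi$ is satisfiable in some model of $T$ iff $\phi$ is satisfiable in some $\mathfrak{B}\in L_n$. With $\lvert L_n\rvert \coloneqq \sum_{\mathfrak{B}\in L_n}\lvert B\rvert$, a sampling is polynomial if there is a polynomial $p\in\mathbb{Z}[x]$ with $\lvert L_n\rvert\le p(n)$ for all $n$. -}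

module Defs where

open import Level using (Level; suc; _⊔_) renaming (zero to lzero)
open import Data.Nat using (ℕ; _+_)
open import Data.Fin using (Fin)
open import Data.Bool using (Bool; T)
open import Data.List using (List; []; _∷_)
open import Data.List.Relation.Unary.All using (All)
open import Data.List.Membership.Propositional using (_∈_)
open import Data.Product using (Σ; _×_; ∃)
open import Data.Empty using (⊥)
open import Relation.Nullary using (¬_)
open import Relation.Binary.PropositionalEquality using (_≡_)
open import Function.Bundles using (_⇔_)
open import Data.Integer as ℤ using (ℤ; +_)

data Rel : Set where
  E N : Rel

record Structure : Set₁ where
  field
    Carrier : Set
    rel     : Rel → Carrier → Carrier → Set
open Structure public

ModelT : Structure → Set
ModelT 𝔐 = ∀ (x y : Carrier 𝔐) →
    ¬ rel 𝔐 E x x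
  × ¬ (rel 𝔐 E x y × ¬ rel 𝔐 E y x)
  × ¬ rel 𝔐 N x x
  × ¬ (rel 𝔐 E x y × rel 𝔐 N x y)

-- Atomic τ-formulas in the variables x_0 … x_{n-1} (i.e. Fin n),
-- and conjunctions of them (a list of atoms; [] is the empty conjunction).

data Atom (n : ℕ) : Set where
  atom : Rel → Fin n → Fin n → Atom n
  eq  : Fin n → Fin n → Atom n
  bot : Atom n

Conj : ℕ → Set
Conj n = List (Atom n)

holds : ∀ {n} (𝔐 : Structure) → (Fin n → Carrier 𝔐) → Atom n → Set
holds 𝔐 a (atom R i j) = rel 𝔐 R (a i) (a j)
holds 𝔐 a (eq i j)    = a i ≡ a j
holds 𝔐 a bot         = ⊥

Sat : ∀ {n} → Structure → Conj n → Set
Sat {n} 𝔐 φ = Σ (Fin n → Carrier 𝔐) λ a → All (holds 𝔐 a) φ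

SatT : ∀ {n} → Conj n → Set₁
SatT φ = Σ Structure λ 𝔐 → ModelT 𝔐 × Sat 𝔐 φ

record FinStructure : Set where
  field
    size : ℕ
    frel : Rel → Fin size → Fin size → Bool
open FinStructure public

toStructure : FinStructure → Structure
toStructure 𝔅 = record { Carrier = Fin (size 𝔅) ; rel = λ R i j → T (frel 𝔅 R i j) }

totalSize : List FinStructure → ℕ
totalSize []      = 0
totalSize (𝔅 ∷ L) = size 𝔅 + totalSize L

IsSampling : (ℕ → List FinStructure) → Set₁
IsSampling L = ∀ (n : ℕ) (φ : Conj n) →
  SatT φ ⇔ (Σ FinStructure λ 𝔅 → 𝔅 ∈ L n × Sat (toStructure 𝔅) φ)

-- Polynomials in ℤ[x] as coefficient lists (constant term first).

evalPoly : List ℤ → ℤ → ℤ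
evalPoly []       x = + 0
evalPoly (c ∷ cs) x = c ℤ.+ x ℤ.* evalPoly cs x

IsPolynomialSize : (ℕ → List FinStructure) → Set
IsPolynomialSize L = Σ (List ℤ) λ p → ∀ (n : ℕ) → + (totalSize (L n)) ℤ.≤ evalPoly p (+ n)

-- A sampling is obtained by listing, for each n, all structures on n points that are
-- models of T after a normalisation (make E symmetric, remove loops, remove E-edges
-- from N): every satisfiable φ in n variables is satisfied in the "canonical"
-- structure read off φ itself, which is one of them.
--
-- Against a polynomial sampling L, consider the 2^(m²) conjunctions in n = 2m variables
-- that put, for each pair (i, j), either an E-edge or an N-edge from the i-th left to the
-- j-th right variable. All are satisfiable, hence satisfiable in the disjoint union of
-- L n, a structure with |L n| points in which no pair carries both E and N (since
-- E(x,y) ∧ N(x,y) is unsatisfiable). There a satisfying assignment determines the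
-- conjunction, so 2^(m²) ≤ |L n|^(2m), which no polynomial bound on |L n| allows.
module Submission where

open import Defs
open import Data.Bool using (Bool; true; false; T; not; _∧_; _∨_; if_then_else_)
open import Data.Bool.Properties using (T-∧; T-∨; ∨-comm)
open import Data.Empty using (⊥; ⊥-elim)
open import Data.Fin using (Fin; zero; suc; _↑ˡ_; _↑ʳ_; splitAt; combine; funToFin; finToFun; _≟_)
import Data.Fin.Properties as Finₚ
open import Data.Integer as ℤ using (ℤ; +_; -[1+_]; ∣_∣)
import Data.Integer.Properties as ℤₚ
open import Data.List using (List; []; _∷_; length; allFin; cartesianProductWith)
open import Data.List.Membership.Propositional using (_∈_; find; lose)
open import Data.List.Membership.Propositional.Properties
  using (∈-cartesianProductWith⁺; ∈-cartesianProductWith⁻; ∈-allFin)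
open import Data.List.Relation.Unary.All as All using (All; []; _∷_)
open import Data.List.Relation.Unary.Any using (here; there; any?)
open import Data.Nat using (ℕ; zero; suc; _+_; _*_; _^_; _≤_; _<_; z≤n; s≤s)
import Data.Nat.Properties as ℕₚ
open import Data.Nat.Tactic.RingSolver using (solve-∀)
open import Data.Product using (Σ; Σ-syntax; ∃; _×_; _,_; proj₁; proj₂)
open import Data.Sum using (_⊎_; inj₁; inj₂; [_,_]′)
open import Data.Vec using (Vec; []; _∷_; lookup; tabulate)
open import Data.Vec.Properties using (lookup∘tabulate)
open import Function using (_∘_; id)
open import Function.Bundles using (Equivalence; mk⇔)
open import Relation.Nullary using (¬_; Dec; yes; no; does)
open import Relation.Nullary.Decidable using (⌊_⌋; _×-dec_; toWitness; fromWitness; dec-true)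
open import Relation.Unary using (Decidable)
open import Relation.Binary.PropositionalEquality
  using (_≡_; _≢_; refl; sym; trans; cong; cong₂; subst; subst₂; module ≡-Reasoning)

open Equivalence using (to; from)

module _ {𝔐 : Structure} (model : ModelT 𝔐) where

  E-irrefl : ∀ {x} → ¬ rel 𝔐 E x x
  E-irrefl {x} = proj₁ (model x x)

  N-irrefl : ∀ {x} → ¬ rel 𝔐 N x x
  N-irrefl {x} = proj₁ (proj₂ (proj₂ (model x x)))

  E∧N-absurd : ∀ {x y} → rel 𝔐 E x y → ¬ rel 𝔐 N x y
  E∧N-absurd {x} {y} e n = proj₂ (proj₂ (proj₂ (model x y))) (e , n)

  -- T only says that E is symmetric up to double negation; that suffices here.
  Eᵒᵖ∧N-absurd : ∀ {x y} → rel 𝔐 E y x → ¬ rel 𝔐 N x y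
  Eᵒᵖ∧N-absurd {x} {y} e n = proj₁ (proj₂ (model y x)) (e , λ e′ → E∧N-absurd e′ n)

E≢N : E ≢ N
E≢N ()

_≟ᴿ_ : (R R′ : Rel) → Dec (R ≡ R′)
E ≟ᴿ E = yes refl
E ≟ᴿ N = no E≢N
N ≟ᴿ E = no (E≢N ∘ sym)
N ≟ᴿ N = yes refl

record Hom (𝔄 𝔅 : Structure) : Set where
  field
    map       : Carrier 𝔄 → Carrier 𝔅
    preserves : ∀ R {x y} → rel 𝔄 R x y → rel 𝔅 R (map x) (map y)
open Hom

_∘ᴴ_ : ∀ {𝔄 𝔅 ℭ} → Hom 𝔅 ℭ → Hom 𝔄 𝔅 → Hom 𝔄 ℭ
g ∘ᴴ h = record { map = map g ∘ map h ; preserves = λ R → preserves g R ∘ preserves h R }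

holds-hom : ∀ {𝔄 𝔅 n} (f : Hom 𝔄 𝔅) {a : Fin n → Carrier 𝔄} {at : Atom n} →
  holds 𝔄 a at → holds 𝔅 (map f ∘ a) at
holds-hom f {at = atom R i j} = preserves f R
holds-hom f {at = eq i j}     = cong (map f)
holds-hom f {at = bot}        = id

Sat-hom : ∀ {𝔄 𝔅 n} {φ : Conj n} → Hom 𝔄 𝔅 → Sat 𝔄 φ → Sat 𝔅 φ
Sat-hom f (a , sat) = map f ∘ a , All.map (λ {at} → holds-hom f {a} {at}) sat

holds-≗ : ∀ {𝔄 n} {a a′ : Fin n → Carrier 𝔄} → (∀ i → a i ≡ a′ i) →
  {at : Atom n} → holds 𝔄 a at → holds 𝔄 a′ at
holds-≗ {𝔄} a≗a′ {atom R i j} = subst₂ (rel 𝔄 R) (a≗a′ i) (a≗a′ j)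
holds-≗ a≗a′ {eq i j} aᵢ≡aⱼ    = trans (sym (a≗a′ i)) (trans aᵢ≡aⱼ (a≗a′ j))
holds-≗ a≗a′ {bot}             = id

-- Normalised tables

¬T⇒T-not : ∀ {b} → ¬ T b → T (not b)
¬T⇒T-not {false} _  = _
¬T⇒T-not {true}  ¬t = ¬t _

T-not⇒¬T : ∀ {b} → T (not b) → ¬ T b
T-not⇒¬T {false} _ ()

offDiagonal : ∀ {n} → Fin n → Fin n → Bool → Bool
offDiagonal x y b = if does (x ≟ y) then false else b

offDiagonal-intro : ∀ {n} {x y : Fin n} {b} → x ≢ y → T b → T (offDiagonal x y b)
offDiagonal-intro {x = x} {y} x≢y t with x ≟ y
... | yes x≡y = x≢y x≡y
... | no _    = t

offDiagonal-elim : ∀ {n} {x y : Fin n} {b} → T (offDiagonal x y b) → x ≢ y × T b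
offDiagonal-elim {x = x} {y} t with x ≟ y
... | yes _   = ⊥-elim t
... | no x≢y = x≢y , t

normalised : ∀ {n} → (Rel → Fin n → Fin n → Bool) → Rel → Fin n → Fin n → Bool
normalised t E x y = offDiagonal x y (t E x y ∨ t E y x)
normalised t N x y = offDiagonal x y (not (t E x y ∨ t E y x) ∧ t N x y)

normalise : ∀ {n} → (Rel → Fin n → Fin n → Bool) → FinStructure
normalise {n} t = record { size = n ; frel = normalised t }

module _ {n} (t : Rel → Fin n → Fin n → Bool) {x y : Fin n} where

  normalised-E-sym : T (normalised t E x y) → T (normalised t E y x)
  normalised-E-sym e =
    let x≢y , e′ = offDiagonal-elim {x = x} {y} e
    in offDiagonal-intro {x = y} {x} (x≢y ∘ sym) (subst T (∨-comm (t E x y) (t E y x)) e′)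

  normalised-E∧N-absurd : T (normalised t E x y) → ¬ T (normalised t N x y)
  normalised-E∧N-absurd e n =
    T-not⇒¬T (proj₁ (to T-∧ (proj₂ (offDiagonal-elim {x = x} {y} n))))
      (proj₂ (offDiagonal-elim {x = x} {y} e))

  normalised-E-intro : x ≢ y → T (t E x y) → T (normalised t E x y)
  normalised-E-intro x≢y e = offDiagonal-intro x≢y (from T-∨ (inj₁ e))

  normalised-N-intro : x ≢ y → ¬ T (t E x y) → ¬ T (t E y x) → T (t N x y) →
    T (normalised t N x y)
  normalised-N-intro x≢y ¬e ¬eᵒᵖ n =
    offDiagonal-intro x≢y (from T-∧ (¬T⇒T-not ([ ¬e , ¬eᵒᵖ ]′ ∘ to T-∨) , n))

normalise-model : ∀ {n} (t : Rel → Fin n → Fin n → Bool) → ModelT (toStructure (normalise t))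
normalise-model t x y =
    (λ e → proj₁ (offDiagonal-elim {x = x} {x} e) refl)
  , (λ (e , ¬eᵒᵖ) → ¬eᵒᵖ (normalised-E-sym t e))
  , (λ n → proj₁ (offDiagonal-elim {x = x} {x} n) refl)
  , (λ (e , n) → normalised-E∧N-absurd t e n)

normalise-cong : ∀ {n} {t t′ : Rel → Fin n → Fin n → Bool} → (∀ R x y → t R x y ≡ t′ R x y) →
  Hom (toStructure (normalise t)) (toStructure (normalise t′))
normalise-cong {t = t} {t′} t≗t′ =
  record { map = id ; preserves = λ R {x} {y} → subst T (agree R x y) }
  where
  agree : ∀ R x y → normalised t R x y ≡ normalised t′ R x y
  agree E x y rewrite t≗t′ E x y | t≗t′ E y x = refl
  agree N x y rewrite t≗t′ E x y | t≗t′ E y x | t≗t′ N x y = refl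

-- The sampling

vectors : ∀ {A : Set} → List A → (k : ℕ) → List (Vec A k)
vectors xs zero    = [] ∷ []
vectors xs (suc k) = cartesianProductWith _∷_ xs (vectors xs k)

∈-vectors : ∀ {A : Set} {xs : List A} → (∀ x → x ∈ xs) → ∀ {k} (v : Vec A k) → v ∈ vectors xs k
∈-vectors ∈xs []      = here refl
∈-vectors ∈xs (x ∷ v) = ∈-cartesianProductWith⁺ _∷_ (∈xs x) (∈-vectors ∈xs v)

∈-booleans : ∀ b → b ∈ true ∷ false ∷ []
∈-booleans true  = here refl
∈-booleans false = there (here refl)

Table : ℕ → Set
Table n = Vec (Vec Bool n) n

tables : ∀ n → List (Table n)
tables n = vectors (vectors (true ∷ false ∷ []) n) n

∈-tables : ∀ {n} (t : Table n) → t ∈ tables n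
∈-tables = ∈-vectors (∈-vectors ∈-booleans)

entry : ∀ {n} → Table n → Fin n → Fin n → Bool
entry t x y = lookup (lookup t x) y

tabulate² : ∀ {n} → (Fin n → Fin n → Bool) → Table n
tabulate² f = tabulate (tabulate ∘ f)

entry-tabulate² : ∀ {n} (f : Fin n → Fin n → Bool) x y → entry (tabulate² f) x y ≡ f x y
entry-tabulate² f x y =
  trans (cong (λ row → lookup row y) (lookup∘tabulate (tabulate ∘ f) x)) (lookup∘tabulate (f x) y)

relTable : ∀ {n} → Table n → Table n → Rel → Fin n → Fin n → Bool
relTable tE tN E = entry tE
relTable tE tN N = entry tN

sample : ℕ → List FinStructure
sample n = cartesianProductWith (λ tE tN → normalise (relTable tE tN)) (tables n) (tables n)

sample-models : ∀ {n 𝔅} → 𝔅 ∈ sample n → ModelT (toStructure 𝔅)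
sample-models {n} mem with ∈-cartesianProductWith⁻ _ (tables n) (tables n) mem
... | tE , tN , _ , _ , refl = normalise-model (relTable tE tN)

sample-complete : ∀ {n} (t : Rel → Fin n → Fin n → Bool) →
  Σ[ 𝔅 ∈ FinStructure ] 𝔅 ∈ sample n × Hom (toStructure (normalise t)) (toStructure 𝔅)
sample-complete t =
  _ , ∈-cartesianProductWith⁺ _ (∈-tables (tabulate² (t E))) (∈-tables (tabulate² (t N))) ,
  normalise-cong agree
  where
  agree : ∀ R x y → t R x y ≡ relTable (tabulate² (t E)) (tabulate² (t N)) R x y
  agree E x y = sym (entry-tabulate² (t E) x y)
  agree N x y = sym (entry-tabulate² (t N) x y)

-- Equality atoms are realised by identifying variables: each atom i = j redirects the
-- class of i to that of j.
redirect : ∀ {n} → Fin n → Fin n → Fin n → Fin n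
redirect u v w = if does (w ≟ u) then v else w

redirect-source : ∀ {n} (u v : Fin n) → redirect u v u ≡ v
redirect-source u v = cong (λ b → if b then v else u) (dec-true (u ≟ u) refl)

redirect-target : ∀ {n} (u v : Fin n) → redirect u v v ≡ v
redirect-target u v with v ≟ u
... | yes _ = refl
... | no _  = refl

representative : ∀ {n} → Conj n → Fin n → Fin n
representative []               x = x
representative (eq i j ∷ φ)     x =
  redirect (representative φ i) (representative φ j) (representative φ x)
representative (atom _ _ _ ∷ φ) x = representative φ x
representative (bot ∷ φ)        x = representative φ x

representative-eq : ∀ {n} (φ : Conj n) {i j} → eq i j ∈ φ → representative φ i ≡ representative φ j
representative-eq (eq i j ∷ φ) (here refl) =
  trans (redirect-source (representative φ i) (representative φ j))
        (sym (redirect-target (representative φ i) (representative φ j)))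
representative-eq (eq i j ∷ φ) (there mem) =
  cong (redirect (representative φ i) (representative φ j)) (representative-eq φ mem)
representative-eq (atom _ _ _ ∷ φ) (there mem) = representative-eq φ mem
representative-eq (bot ∷ φ)        (there mem) = representative-eq φ mem

representative-sound : ∀ {𝔐 n} (φ : Conj n) {a : Fin n → Carrier 𝔐} → All (holds 𝔐 a) φ →
  ∀ x → a (representative φ x) ≡ a x
representative-sound []               _         x = refl
representative-sound (atom _ _ _ ∷ φ) (_ ∷ sat) x = representative-sound φ sat x
representative-sound (eq i j ∷ φ) {a} (aᵢ≡aⱼ ∷ sat) x
  with representative φ x ≟ representative φ i
... | no _        = representative-sound φ sat x
... | yes ρx≡ρi = begin
  a (representative φ j) ≡⟨ representative-sound φ sat j ⟩
  a j                    ≡⟨ sym aᵢ≡aⱼ ⟩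
  a i                    ≡⟨ sym (representative-sound φ sat i) ⟩
  a (representative φ i) ≡⟨ cong a (sym ρx≡ρi) ⟩
  a (representative φ x) ≡⟨ representative-sound φ sat x ⟩
  a x                    ∎
  where open ≡-Reasoning

Asserts : ∀ {n} → (Fin n → Fin n) → Rel → Fin n → Fin n → Atom n → Set
Asserts ρ R x y (atom R′ i j) = R′ ≡ R × ρ i ≡ x × ρ j ≡ y
Asserts ρ R x y (eq _ _)      = ⊥
Asserts ρ R x y bot           = ⊥

asserts? : ∀ {n} (ρ : Fin n → Fin n) R x y → Decidable (Asserts ρ R x y)
asserts? ρ R x y (atom R′ i j) = R′ ≟ᴿ R ×-dec ρ i ≟ x ×-dec ρ j ≟ y
asserts? ρ R x y (eq _ _)      = no λ ()
asserts? ρ R x y bot           = no λ ()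

asserted : ∀ {n} → Conj n → Rel → Fin n → Fin n → Bool
asserted φ R x y = ⌊ any? (asserts? (representative φ) R x y) φ ⌋

asserted-complete : ∀ {n} {φ : Conj n} {R i j} → atom R i j ∈ φ →
  T (asserted φ R (representative φ i) (representative φ j))
asserted-complete mem = fromWitness (lose mem (refl , refl , refl))

asserted-sound : ∀ {𝔐 n} {φ : Conj n} {a : Fin n → Carrier 𝔐} → All (holds 𝔐 a) φ →
  ∀ {R x y} → T (asserted φ R x y) → rel 𝔐 R (a x) (a y)
asserted-sound {𝔐} {φ = φ} sat t with find (toWitness t)
... | atom R i j , mem , refl , refl , refl =
  subst₂ (rel 𝔐 R) (sym (representative-sound φ sat i)) (sym (representative-sound φ sat j))
    (All.lookup sat mem)
... | eq _ _ , _ , ()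
... | bot    , _ , ()

canonical : ∀ {n} → Conj n → FinStructure
canonical φ = normalise (asserted φ)

canonical-sat : ∀ {𝔐 n} {φ : Conj n} {a : Fin n → Carrier 𝔐} → ModelT 𝔐 → All (holds 𝔐 a) φ →
  Sat (toStructure (canonical φ)) φ
canonical-sat {𝔐} {n} {φ} {a} model sat = ρ , All.tabulate holds-canonical
  where
  ρ : Fin n → Fin n
  ρ = representative φ

  related : ∀ {R} i j → T (asserted φ R (ρ i) (ρ j)) → rel 𝔐 R (a i) (a j)
  related {R} i j t =
    subst₂ (rel 𝔐 R) (representative-sound φ sat i) (representative-sound φ sat j)
      (asserted-sound sat t)

  separated : ∀ {R i j} → (∀ {x} → ¬ rel 𝔐 R x x) → rel 𝔐 R (a i) (a j) → ρ i ≢ ρ j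
  separated {R} {i} {j} irrefl r ρi≡ρj = irrefl (subst (rel 𝔐 R (a i)) (sym aᵢ≡aⱼ) r)
    where
    aᵢ≡aⱼ : a i ≡ a j
    aᵢ≡aⱼ = trans (sym (representative-sound φ sat i))
              (trans (cong a ρi≡ρj) (representative-sound φ sat j))

  holds-canonical : ∀ {at} → at ∈ φ → holds (toStructure (canonical φ)) ρ at
  holds-canonical {atom E i j} mem =
    normalised-E-intro (asserted φ) (separated (E-irrefl {𝔐} model) (All.lookup sat mem))
      (asserted-complete mem)
  holds-canonical {atom N i j} mem =
    normalised-N-intro (asserted φ) (separated (N-irrefl {𝔐} model) nᵢⱼ)
      (λ e → E∧N-absurd {𝔐} model (related i j e) nᵢⱼ)
      (λ e → Eᵒᵖ∧N-absurd {𝔐} model (related j i e) nᵢⱼ)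
      (asserted-complete mem)
    where
    nᵢⱼ : rel 𝔐 N (a i) (a j)
    nᵢⱼ = All.lookup sat mem
  holds-canonical {eq i j} mem = representative-eq φ mem
  holds-canonical {bot}    mem = All.lookup sat mem

sample-isSampling : IsSampling sample
sample-isSampling n φ =
  mk⇔ into (λ (𝔅 , mem , s) → toStructure 𝔅 , sample-models {n} mem , s)
  where
  into : SatT φ → Σ FinStructure λ 𝔅 → 𝔅 ∈ sample n × Sat (toStructure 𝔅) φ
  into (_ , model , _ , sat) =
    let 𝔅 , mem , hom = sample-complete (asserted φ)
    in 𝔅 , mem , Sat-hom hom (canonical-sat model sat)

-- Disjoint unions

sumRel : ∀ {A B : Set} → (A → A → Bool) → (B → B → Bool) → A ⊎ B → A ⊎ B → Bool
sumRel r s (inj₁ x) (inj₁ y) = r x y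
sumRel r s (inj₂ x) (inj₂ y) = s x y
sumRel r s (inj₁ _) (inj₂ _) = false
sumRel r s (inj₂ _) (inj₁ _) = false

_⊕_ : FinStructure → FinStructure → FinStructure
𝔅 ⊕ ℭ = record
  { size = size 𝔅 + size ℭ
  ; frel = λ R x y → sumRel (frel 𝔅 R) (frel ℭ R) (splitAt (size 𝔅) x) (splitAt (size 𝔅) y)
  }

⨁ : List FinStructure → FinStructure
⨁ []      = record { size = 0 ; frel = λ _ () }
⨁ (𝔅 ∷ L) = 𝔅 ⊕ ⨁ L

size-⨁ : ∀ L → size (⨁ L) ≡ totalSize L
size-⨁ []      = refl
size-⨁ (𝔅 ∷ L) = cong (λ s → size 𝔅 + s) (size-⨁ L)

⊕-inj₁ : ∀ 𝔅 ℭ → Hom (toStructure 𝔅) (toStructure (𝔅 ⊕ ℭ))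
⊕-inj₁ 𝔅 ℭ = record { map = _↑ˡ size ℭ ; preserves = preserve }
  where
  preserve : ∀ R {x y} → T (frel 𝔅 R x y) → T (frel (𝔅 ⊕ ℭ) R (x ↑ˡ size ℭ) (y ↑ˡ size ℭ))
  preserve R {x} {y} r
    rewrite Finₚ.splitAt-↑ˡ (size 𝔅) x (size ℭ) | Finₚ.splitAt-↑ˡ (size 𝔅) y (size ℭ) = r

⊕-inj₂ : ∀ 𝔅 ℭ → Hom (toStructure ℭ) (toStructure (𝔅 ⊕ ℭ))
⊕-inj₂ 𝔅 ℭ = record { map = size 𝔅 ↑ʳ_ ; preserves = preserve }
  where
  preserve : ∀ R {x y} → T (frel ℭ R x y) → T (frel (𝔅 ⊕ ℭ) R (size 𝔅 ↑ʳ x) (size 𝔅 ↑ʳ y))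
  preserve R {x} {y} r
    rewrite Finₚ.splitAt-↑ʳ (size 𝔅) (size ℭ) x | Finₚ.splitAt-↑ʳ (size 𝔅) (size ℭ) y = r

∈-⨁ : ∀ {𝔅 L} → 𝔅 ∈ L → Hom (toStructure 𝔅) (toStructure (⨁ L))
∈-⨁ {L = 𝔅 ∷ L} (here refl) = ⊕-inj₁ 𝔅 (⨁ L)
∈-⨁ {L = ℭ ∷ L} (there mem) = ⊕-inj₂ ℭ (⨁ L) ∘ᴴ ∈-⨁ mem

EN-Disjoint : Structure → Set
EN-Disjoint 𝔄 = ∀ {x y} → rel 𝔄 E x y → ¬ rel 𝔄 N x y

EN-Disjoint-unique : ∀ {𝔄} → EN-Disjoint 𝔄 → ∀ {R R′ x y} → rel 𝔄 R x y → rel 𝔄 R′ x y → R ≡ R′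
EN-Disjoint-unique disj {E} {E} _ _ = refl
EN-Disjoint-unique disj {N} {N} _ _ = refl
EN-Disjoint-unique disj {E} {N} e n = ⊥-elim (disj e n)
EN-Disjoint-unique disj {N} {E} n e = ⊥-elim (disj e n)

sumRel-EN-Disjoint : ∀ 𝔅 ℭ → EN-Disjoint (toStructure 𝔅) → EN-Disjoint (toStructure ℭ) →
  ∀ x y → T (sumRel (frel 𝔅 E) (frel ℭ E) x y) → ¬ T (sumRel (frel 𝔅 N) (frel ℭ N) x y)
sumRel-EN-Disjoint 𝔅 ℭ disj₁ disj₂ (inj₁ x) (inj₁ y) = disj₁
sumRel-EN-Disjoint 𝔅 ℭ disj₁ disj₂ (inj₂ x) (inj₂ y) = disj₂
sumRel-EN-Disjoint 𝔅 ℭ disj₁ disj₂ (inj₁ _) (inj₂ _) = λ ()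
sumRel-EN-Disjoint 𝔅 ℭ disj₁ disj₂ (inj₂ _) (inj₁ _) = λ ()

⨁-EN-Disjoint : ∀ L → (∀ {𝔅} → 𝔅 ∈ L → EN-Disjoint (toStructure 𝔅)) →
  EN-Disjoint (toStructure (⨁ L))
⨁-EN-Disjoint []      _    {()}
⨁-EN-Disjoint (𝔅 ∷ L) disj {x} {y} =
  sumRel-EN-Disjoint 𝔅 (⨁ L) (disj (here refl)) (⨁-EN-Disjoint L (disj ∘ there))
    (splitAt (size 𝔅) x) (splitAt (size 𝔅) y)

E∧N-unsatisfiable : ∀ {n} (u v : Fin n) → ¬ SatT (atom E u v ∷ atom N u v ∷ [])
E∧N-unsatisfiable u v (𝔐 , model , _ , (e ∷ n ∷ [])) = E∧N-absurd {𝔐} model e n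

module _ {L : ℕ → List FinStructure} (sampling : IsSampling L) where

  sampling-EN-Disjoint : ∀ {n} {u v : Fin n} → u ≢ v →
    ∀ {𝔅} → 𝔅 ∈ L n → EN-Disjoint (toStructure 𝔅)
  sampling-EN-Disjoint {n} {u} {v} u≢v {𝔅} mem {x} {y} e r =
    E∧N-unsatisfiable u v
      (from (sampling n (atom E u v ∷ atom N u v ∷ [])) (𝔅 , mem , a , (eₓᵧ ∷ nₓᵧ ∷ [])))
    where
    a : Fin n → Fin (size 𝔅)
    a w = if does (w ≟ u) then x else y

    aᵤ : a u ≡ x
    aᵤ = cong (λ b → if b then x else y) (dec-true (u ≟ u) refl)

    aᵥ : a v ≡ y
    aᵥ with v ≟ u
    ... | yes v≡u = ⊥-elim (u≢v (sym v≡u))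
    ... | no _    = refl

    eₓᵧ : T (frel 𝔅 E (a u) (a v))
    eₓᵧ = subst₂ (λ p q → T (frel 𝔅 E p q)) (sym aᵤ) (sym aᵥ) e

    nₓᵧ : T (frel 𝔅 N (a u) (a v))
    nₓᵧ = subst₂ (λ p q → T (frel 𝔅 N p q)) (sym aᵤ) (sym aᵥ) r

  sampling-⨁ : ∀ {n} {φ : Conj n} → SatT φ → Sat (toStructure (⨁ (L n))) φ
  sampling-⨁ {n} {φ} s = let _ , mem , sat = to (sampling n φ) s in Sat-hom (∈-⨁ mem) sat

-- Complete bipartite E/N-patterns

module _ (m : ℕ) where

  left right : Fin m → Fin (m + m)
  left  i = i ↑ˡ m
  right j = m ↑ʳ j

  left≢right : ∀ i j → left i ≢ right j
  left≢right i j i≡j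
    with () ← trans (sym (Finₚ.splitAt-↑ˡ m i m)) (trans (cong (splitAt m) i≡j) (Finₚ.splitAt-↑ʳ m m j))

  bipartite : (Fin m → Fin m → Rel) → Conj (m + m)
  bipartite e = cartesianProductWith (λ i j → atom (e i j) (left i) (right j)) (allFin m) (allFin m)

  ∈-bipartite : ∀ e i j → atom (e i j) (left i) (right j) ∈ bipartite e
  ∈-bipartite e i j = ∈-cartesianProductWith⁺ _ (∈-allFin i) (∈-allFin j)

  edges : (Fin m → Fin m → Rel) → Rel → Fin m ⊎ Fin m → Fin m ⊎ Fin m → Set
  edges e R (inj₁ i) (inj₂ j) = e i j ≡ R
  edges e E (inj₂ j) (inj₁ i) = e i j ≡ E
  edges e N (inj₂ _) (inj₁ _) = ⊥
  edges e R (inj₁ _) (inj₁ _) = ⊥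
  edges e R (inj₂ _) (inj₂ _) = ⊥

  bipartite-satisfiable : ∀ e → SatT (bipartite e)
  bipartite-satisfiable e = 𝔐 , model , splitAt m , All.tabulate holds-edge
    where
    𝔐 : Structure
    𝔐 = record { Carrier = Fin m ⊎ Fin m ; rel = edges e }

    model : ModelT 𝔐
    model (inj₁ _) (inj₁ _) = (λ ()) , (λ ()) , (λ ()) , (λ ())
    model (inj₂ _) (inj₂ _) = (λ ()) , (λ ()) , (λ ()) , (λ ())
    model (inj₁ i) (inj₂ j) = (λ ()) , (λ (e , ¬eᵒᵖ) → ¬eᵒᵖ e) , (λ ()) , λ (toE , toN) → E≢N (trans (sym toE) toN)
    model (inj₂ j) (inj₁ i) = (λ ()) , (λ (e , ¬eᵒᵖ) → ¬eᵒᵖ e) , (λ ()) , λ ()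

    holds-edge : ∀ {at} → at ∈ bipartite e → holds 𝔐 (splitAt m) at
    holds-edge mem with ∈-cartesianProductWith⁻ _ (allFin m) (allFin m) mem
    ... | i , j , _ , _ , refl rewrite Finₚ.splitAt-↑ˡ m i m | Finₚ.splitAt-↑ʳ m m j = refl

  bipartite-determined : ∀ {𝔄} → EN-Disjoint 𝔄 → ∀ {a : Fin (m + m) → Carrier 𝔄} {e e′} →
    All (holds 𝔄 a) (bipartite e) → All (holds 𝔄 a) (bipartite e′) → ∀ i j → e i j ≡ e′ i j
  bipartite-determined {𝔄} disj sat sat′ i j =
    EN-Disjoint-unique {𝔄} disj (All.lookup sat (∈-bipartite _ i j)) (All.lookup sat′ (∈-bipartite _ i j))

funToFin-cong : ∀ {a b} {f g : Fin a → Fin b} → (∀ x → f x ≡ g x) → funToFin f ≡ funToFin g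
funToFin-cong {zero}  f≗g = refl
funToFin-cong {suc a} f≗g = cong₂ combine (f≗g zero) (funToFin-cong (f≗g ∘ suc))

finToFun-injective : ∀ {a b} {k k′ : Fin (b ^ a)} →
  (∀ x → finToFun {b} {a} k x ≡ finToFun k′ x) → k ≡ k′
finToFun-injective {a} {b} {k} {k′} k≗k′ = begin
  k                               ≡⟨ sym (Finₚ.funToFin-finToFin {a} {b} k) ⟩
  funToFin (finToFun {b} {a} k)  ≡⟨ funToFin-cong k≗k′ ⟩
  funToFin (finToFun {b} {a} k′) ≡⟨ Finₚ.funToFin-finToFin {a} {b} k′ ⟩
  k′                              ∎
  where open ≡-Reasoning

relOf : Fin 2 → Rel
relOf zero    = E
relOf (suc _) = N

relOf-injective : ∀ {f g} → relOf f ≡ relOf g → f ≡ g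
relOf-injective {zero}     {zero}     _ = refl
relOf-injective {suc zero} {suc zero} _ = refl
relOf-injective {zero}     {suc _}    ()
relOf-injective {suc _}    {zero}     ()

-- Each pattern is coded by a binary string of length m², and an assignment of the
-- 2m variables is an element of Fin (size 𝔅 ^ (m + m)).
bipartite-count : ∀ m 𝔅 → EN-Disjoint (toStructure 𝔅) →
  (∀ e → Sat (toStructure 𝔅) (bipartite m e)) → 2 ^ (m * m) ≤ size 𝔅 ^ (m + m)
bipartite-count m 𝔅 disj sat = Finₚ.injective⇒≤ code-injective
  where
  pattern′ : Fin (2 ^ (m * m)) → Fin m → Fin m → Rel
  pattern′ k i j = relOf (finToFun k (combine i j))

  assignment : Fin (2 ^ (m * m)) → Fin (m + m) → Fin (size 𝔅)
  assignment k = proj₁ (sat (pattern′ k))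

  code-injective : ∀ {k k′} → funToFin (assignment k) ≡ funToFin (assignment k′) → k ≡ k′
  code-injective {k} {k′} same = finToFun-injective {m * m} {2} agree
    where
    assignments-agree : ∀ x → assignment k′ x ≡ assignment k x
    assignments-agree x =
      trans (sym (Finₚ.finToFun-funToFin (assignment k′) x))
        (trans (cong (λ c → finToFun c x) (sym same)) (Finₚ.finToFun-funToFin (assignment k) x))

    agree : ∀ c → finToFun {2} {m * m} k c ≡ finToFun k′ c
    agree c with Finₚ.combine-surjective {m} {m} c
    ... | i , j , refl = relOf-injective
      (bipartite-determined m disj (proj₂ (sat (pattern′ k)))
        (All.map (λ {at} → holds-≗ assignments-agree {at}) (proj₂ (sat (pattern′ k′)))) i j)

sampling-lower-bound : ∀ {L} → IsSampling L → ∀ m → 2 ^ (m * m) ≤ totalSize (L (m + m)) ^ (m + m)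
sampling-lower-bound samp zero = ℕₚ.≤-refl
sampling-lower-bound {L} samp m@(suc _) =
  subst (λ s → 2 ^ (m * m) ≤ s ^ (m + m)) (size-⨁ (L (m + m)))
    (bipartite-count m (⨁ (L (m + m)))
      (⨁-EN-Disjoint (L (m + m)) (sampling-EN-Disjoint samp (left≢right m zero zero)))
      (λ e → sampling-⨁ samp (bipartite-satisfiable m e)))

-- Polynomial versus exponential growth

absSum : List ℤ → ℕ
absSum []       = 0
absSum (c ∷ cs) = ∣ c ∣ + absSum cs

evalAbs : List ℤ → ℕ → ℕ
evalAbs []       n = 0
evalAbs (c ∷ cs) n = ∣ c ∣ + n * evalAbs cs n

i≤+∣i∣ : ∀ i → i ℤ.≤ + ∣ i ∣
i≤+∣i∣ (+ n)    = ℤ.+≤+ ℕₚ.≤-refl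
i≤+∣i∣ -[1+ n ] = ℤ.-≤+

evalPoly-≤-evalAbs : ∀ p n → evalPoly p (+ n) ℤ.≤ + evalAbs p n
evalPoly-≤-evalAbs []       n = ℤ.+≤+ z≤n
evalPoly-≤-evalAbs (c ∷ cs) n = begin
  c ℤ.+ + n ℤ.* evalPoly cs (+ n)   ≤⟨ ℤₚ.+-mono-≤ (i≤+∣i∣ c) (ℤₚ.*-monoˡ-≤-nonNeg (+ n) (evalPoly-≤-evalAbs cs n)) ⟩
  + ∣ c ∣ ℤ.+ + n ℤ.* + evalAbs cs n ≡⟨ cong (λ i → + ∣ c ∣ ℤ.+ i) (sym (ℤₚ.pos-* n (evalAbs cs n))) ⟩
  + ∣ c ∣ ℤ.+ + (n * evalAbs cs n)   ≡⟨ sym (ℤₚ.pos-+ ∣ c ∣ (n * evalAbs cs n)) ⟩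
  + evalAbs (c ∷ cs) n               ∎
  where open ℤₚ.≤-Reasoning

evalAbs-≤ : ∀ p n → evalAbs p n ≤ absSum p * suc n ^ length p
evalAbs-≤ []       n = z≤n
evalAbs-≤ (c ∷ cs) n = begin
  ∣ c ∣ + n * evalAbs cs n             ≤⟨ ℕₚ.+-mono-≤ ∣c∣≤∣c∣*Y (ℕₚ.*-monoʳ-≤ n (evalAbs-≤ cs n)) ⟩
  ∣ c ∣ * Y + n * (absSum cs * X)       ≤⟨ ℕₚ.+-monoʳ-≤ (∣ c ∣ * Y) (ℕₚ.m≤n+m _ (absSum cs * X)) ⟩
  ∣ c ∣ * Y + (absSum cs * X + n * (absSum cs * X)) ≡⟨ distribute ∣ c ∣ (absSum cs) n X ⟩
  (∣ c ∣ + absSum cs) * Y               ∎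
  where
  open ℕₚ.≤-Reasoning
  X Y : ℕ
  X = suc n ^ length cs
  Y = suc n * X

  ∣c∣≤∣c∣*Y : ∣ c ∣ ≤ ∣ c ∣ * Y
  ∣c∣≤∣c∣*Y = ℕₚ.m≤m*n ∣ c ∣ Y {{ℕₚ.m^n≢0 (suc n) (length (c ∷ cs))}}

  distribute : ∀ a s n x → a * (suc n * x) + (s * x + n * (s * x)) ≡ (a + s) * (suc n * x)
  distribute = solve-∀

polynomial-bound : ∀ (f : ℕ → ℕ) p → (∀ n → + f n ℤ.≤ evalPoly p (+ n)) →
  ∀ n → f n ≤ absSum p * suc n ^ length p
polynomial-bound f p bound n =
  ℕₚ.≤-trans (ℤₚ.drop‿+≤+ (ℤₚ.≤-trans (bound n) (evalPoly-≤-evalAbs p n))) (evalAbs-≤ p n)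

n<2^n : ∀ n → n < 2 ^ n
n<2^n zero    = s≤s z≤n
n<2^n (suc n) = begin-strict
  suc n         ≡⟨ ℕₚ.+-comm 1 n ⟩
  n + 1         <⟨ ℕₚ.+-mono-<-≤ (n<2^n n) (ℕₚ.m^n>0 2 n) ⟩
  2 ^ n + 2 ^ n ≡⟨ cong (λ x → 2 ^ n + x) (sym (ℕₚ.+-identityʳ (2 ^ n))) ⟩
  2 ^ suc n     ∎
  where open ℕₚ.≤-Reasoning

2^-cancel-≤ : ∀ {a b} → 2 ^ a ≤ 2 ^ b → a ≤ b
2^-cancel-≤ le = ℕₚ.≮⇒≥ λ b<a → ℕₚ.<⇒≱ (ℕₚ.^-monoʳ-< 2 (s≤s (s≤s z≤n)) b<a) le

exponential-beats-linear : ∀ a b → ∃ λ k → a + b * k < 2 ^ k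
exponential-beats-linear a b = j + j , (begin-strict
  a + b * (j + j)   <⟨ ℕₚ.+-mono-<-≤ a<1+j b*[j+j]≤j*[1+j] ⟩
  suc j * suc j     ≤⟨ ℕₚ.*-mono-≤ (n<2^n j) (n<2^n j) ⟩
  2 ^ j * 2 ^ j     ≡⟨ sym (ℕₚ.^-distribˡ-+-* 2 j j) ⟩
  2 ^ (j + j)       ∎)
  where
  open ℕₚ.≤-Reasoning
  j : ℕ
  j = a + b + b

  a<1+j : a < suc j
  a<1+j = s≤s (ℕₚ.≤-trans (ℕₚ.m≤m+n a b) (ℕₚ.m≤m+n (a + b) b))

  b*[j+j]≤j*[1+j] : b * (j + j) ≤ j * suc j
  b*[j+j]≤j*[1+j] = begin
    b * (j + j) ≡⟨ commute b j ⟩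
    j * (b + b) ≤⟨ ℕₚ.*-monoʳ-≤ j (ℕₚ.≤-trans (ℕₚ.m≤n+m (b + b) a) (ℕₚ.≤-reflexive (sym (ℕₚ.+-assoc a b b)))) ⟩
    j * j       ≤⟨ ℕₚ.*-monoʳ-≤ j (ℕₚ.n≤1+n j) ⟩
    j * suc j   ∎
    where
    commute : ∀ b j → b * (j + j) ≡ j * (b + b)
    commute = solve-∀

-- With m = 2^k the bound yields 2^k ≤ 2c for a c linear in k.
2^m²-not-polynomially-bounded : ∀ S d → ¬ (∀ m → 2 ^ (m * m) ≤ (S * suc (m + m) ^ d) ^ (m + m))
2^m²-not-polynomially-bounded S d bound = ℕₚ.<⇒≱ linear<2^k (begin
  2 ^ k                         ≤⟨ m≤c+c ⟩
  c + c                         ≡⟨ expand S d k ⟩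
  (S + S + 4 * d) + (d + d) * k ∎)
  where
  open ℕₚ.≤-Reasoning
  k : ℕ
  k = proj₁ (exponential-beats-linear (S + S + 4 * d) (d + d))

  linear<2^k : (S + S + 4 * d) + (d + d) * k < 2 ^ k
  linear<2^k = proj₂ (exponential-beats-linear (S + S + 4 * d) (d + d))

  m c : ℕ
  m = 2 ^ k
  c = S + (2 + k) * d

  expand : ∀ S d k → (S + (2 + k) * d) + (S + (2 + k) * d) ≡ (S + S + 4 * d) + (d + d) * k
  expand = solve-∀

  2m+1≤2^[2+k] : suc (m + m) ≤ 2 ^ (2 + k)
  2m+1≤2^[2+k] = begin
    suc (m + m)       ≡⟨ ℕₚ.+-comm 1 (m + m) ⟩
    m + m + 1         ≤⟨ ℕₚ.+-monoʳ-≤ (m + m) (ℕₚ.≤-trans (ℕₚ.m^n>0 2 k) (ℕₚ.m≤m+n m m)) ⟩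
    m + m + (m + m)   ≡⟨ quadruple m ⟩
    2 ^ (2 + k)       ∎
    where
    quadruple : ∀ m → m + m + (m + m) ≡ 2 * (2 * m)
    quadruple = solve-∀

  base≤2^c : S * suc (m + m) ^ d ≤ 2 ^ c
  base≤2^c = begin
    S * suc (m + m) ^ d     ≤⟨ ℕₚ.*-mono-≤ (ℕₚ.<⇒≤ (n<2^n S)) (ℕₚ.^-monoˡ-≤ d 2m+1≤2^[2+k]) ⟩
    2 ^ S * (2 ^ (2 + k)) ^ d ≡⟨ cong (λ x → 2 ^ S * x) (ℕₚ.^-*-assoc 2 (2 + k) d) ⟩
    2 ^ S * 2 ^ ((2 + k) * d) ≡⟨ sym (ℕₚ.^-distribˡ-+-* 2 S ((2 + k) * d)) ⟩
    2 ^ c                   ∎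

  m*m≤c*[m+m] : m * m ≤ c * (m + m)
  m*m≤c*[m+m] = 2^-cancel-≤ (begin
    2 ^ (m * m)                       ≤⟨ bound m ⟩
    (S * suc (m + m) ^ d) ^ (m + m)   ≤⟨ ℕₚ.^-monoˡ-≤ (m + m) base≤2^c ⟩
    (2 ^ c) ^ (m + m)                 ≡⟨ ℕₚ.^-*-assoc 2 c (m + m) ⟩
    2 ^ (c * (m + m))                 ∎)

  m≤c+c : m ≤ c + c
  m≤c+c = ℕₚ.*-cancelʳ-≤ m (c + c) m {{ℕₚ.m^n≢0 2 k}}
    (ℕₚ.≤-trans m*m≤c*[m+m] (ℕₚ.≤-reflexive (double c m)))
    where
    double : ∀ c m → c * (m + m) ≡ (c + c) * m
    double = solve-∀

lemma2p10 : Σ (ℕ → List FinStructure) IsSampling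
    × ¬ (Σ (ℕ → List FinStructure) λ L → IsSampling L × IsPolynomialSize L)
lemma2p10 = (sample , sample-isSampling) , λ (L , sampling , p , bound) →
  2^m²-not-polynomially-bounded (absSum p) (length p) λ m →
    ℕₚ.≤-trans (sampling-lower-bound sampling m)
      (ℕₚ.^-monoˡ-≤ (m + m) (polynomial-bound (totalSize ∘ L) p bound (m + m)))
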